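{- Let $\mathcal{M}_1=(X_1,\mathcal{N}_1,V_1)$ and $\mathcal{M}_2=(X_2,\mathcal{N}_2,V_2)$ be quasi-discrete neighbourhood models. (1) If $(Z_{\mathcal{N}},Z_1,Z_2)$ is a path preserving bisimulation between $\mathcal{M}_1$ and $\mathcal{M}_2$, then $Z_{\mathcal{N}}$ is a modal bisimulation with converse. (2) If $\rho\subseteq X_1\times X_2$ is a non-empty modal bisimulation with converse, then there are relations $Z_1,Z_2$ such that $(\rho,Z_1,Z_2)$ is a path preserving bisimulation between $\mathcal{M}_1$ and $\mathcal{M}_2$.
   Context: A neighbourhood space $(X,\mathcal{N})$ assigns to each $x\in X$ a filter $\mathcal{N}(x)$ on $X$ (closed under non-empty finite intersections and supersets, $\emptyset\notin\mathcal{N}(x)$) with $x\in N$ for all $N\in\mathcal{N}(x)$. It is quasi-discrete if every $x$ has a minimal neighbourhood $\mathcal{N}_{\min}(x)$. A quasi-discrete neighbourhood model $(X,\mathcal{N},V)$ is a quasi-discrete space with valuation $V:X\to\mathcal{P}(\mathsf{P})$ and index space $\mathbb{N}$ (usual order, least element $0$, minimal neighbourhood of $n$ is $\{n,n+1\}$); paths are continuous maps $p:\mathbb{N}\to X$, i.e. maps with $p(n+1)\in\mathcal{N}_{\min}(p(n))$ for all $n$. Induced edge relation $R=\{(x,y)\mid y\in\mathcal{N}_{\min}(x)\}$. A relation $\rho\subseteq X_1\times X_2$ is a modal bisimulation if for every $x_1\rho x_2$: $V_1(x_1)=V_2(x_2)$; if $(x_1,y_1)\in R_1$ then there is $y_2$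 with $(x_2,y_2)\in R_2$ and $y_1\rho y_2$; if $(x_2,y_2)\in R_2$ then there is $y_1$ with $(x_1,y_1)\in R_1$ and $y_1\rho y_2$. It is a modal bisimulation with converse if additionally for every $x_1\rho x_2$: if $(y_1,x_1)\in R_1$ there is $y_2$ with $(y_2,x_2)\in R_2$ and $y_1\rho y_2$; if $(y_2,x_2)\in R_2$ there is $y_1$ with $(y_1,x_1)\in R_1$ and $y_1\rho y_2$. Neighbourhood bisimulation conditions for a pair $x_1 Z x_2$: (atomic) $V_1(x_1)=V_2(x_2)$; (forth) for every $N_2\in\mathcal{N}_2(x_2)$ there is $N_1\in\mathcal{N}_1(x_1)$ such that every $y_1\in N_1$ has some $y_2\in N_2$ with $y_1Zy_2$; (back) symmetrically. Path preserving bisimulation (with path sets $\mathcal{P}_1,\mathcal{P}_2$, index set $\mathbb{N}$): a triple $(Z_{\mathcal{N}},Z_1,Z_2)$ with $\emptyset\ne Z_{\mathcal{N}}\subseteq X_1\times X_2$, $Z_1\subseteq(\mathcal{P}_1\times\mathbb{N})\times(\mathcal{P}_2\times\mathbb{N})$, $Z_2\subseteq(\mathcal{P}_2\times\mathbb{N})\times(\mathcal{P}_1\times\mathbb{N})$ such that: (1) every pair in $Z_{\mathcal{N}}$ satisfies the neighbourhood bisimulation conditions w.r.t. $Z_{\mathcal{N}}$; (2) if $x_1Z_{\mathcal{N}}x_2$, $p$ a path with $p(0)=x_1$, $n\ne0$, then there are a path $q$ with $q(0)=x_2$ and $m$ with $p(n)Z_{\mathcal{N}}q(m)$ and $(p,n)Z_1(q,m)$;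 (3) if $x_1Z_{\mathcal{N}}x_2$, $p$ a path with $p(n)=x_1$, $n\ne0$, then there are a path $q$ and $m$ with $q(m)=x_2$, $p(0)Z_{\mathcal{N}}q(0)$ and $(p,n)Z_1(q,m)$; (4) if $(p,n)Z_1(q,m)$ and $0<k_q<m$, then there is $k_p$ with $0<k_p<n$ and $p(k_p)Z_{\mathcal{N}}q(k_q)$; (5) if $x_1Z_{\mathcal{N}}x_2$, $q$ a path with $q(0)=x_2$, $m\ne0$, then there are a path $p$ with $p(0)=x_1$ and $n$ with $p(n)Z_{\mathcal{N}}q(m)$ and $(q,m)Z_2(p,n)$; (6) if $x_1Z_{\mathcal{N}}x_2$, $q$ a path with $q(m)=x_2$, $m\ne0$, then there are a path $p$ and $n$ with $p(n)=x_1$, $p(0)Z_{\mathcal{N}}q(0)$ and $(q,m)Z_2(p,n)$; (7) if $(q,m)Z_2(p,n)$ and $0<k_p<n$, then there is $k_q$ with $0<k_q<m$ and $p(k_p)Z_{\mathcal{N}}q(k_q)$. -}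

module Defs where

open import Level using (0ℓ)
open import Data.Nat using (ℕ; zero; suc; _<_)
open import Data.Product using (Σ; ∃; ∃-syntax; _×_; _,_)
open import Relation.Nullary using (¬_)
open import Relation.Binary.PropositionalEquality using (_≡_; _≢_)
open import Relation.Unary using (Pred; _∈_; _⊆_; _∩_; ∅; _≐_)

record NbhdSpace (X : Set) : Set₁ where
  field
    𝒩         : X → Pred (Pred X 0ℓ) 0ℓ
    ∩-closed  : ∀ {x} {A B : Pred X 0ℓ} → A ∈ 𝒩 x → B ∈ 𝒩 x → (A ∩ B) ∈ 𝒩 x
    ⊇-closed  : ∀ {x} {A B : Pred X 0ℓ} → A ∈ 𝒩 x → A ⊆ B → B ∈ 𝒩 x
    ∅-notin   : ∀ {x} → ¬ (∅ ∈ 𝒩 x)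
    point-in  : ∀ {x} {A : Pred X 0ℓ} → A ∈ 𝒩 x → x ∈ A

record QuasiDiscreteSpace (X : Set) : Set₁ where
  field
    space    : NbhdSpace X
  open NbhdSpace space public
  field
    Nmin     : X → Pred X 0ℓ
    Nmin-nbh : ∀ x → Nmin x ∈ 𝒩 x
    Nmin-min : ∀ x {A : Pred X 0ℓ} → A ∈ 𝒩 x → Nmin x ⊆ A

record QDModel (Atom : Set) : Set₁ where
  field
    X     : Set
    qds   : QuasiDiscreteSpace X
    V     : X → Pred Atom 0ℓ
  open QuasiDiscreteSpace qds public

  R : X → X → Set
  R x y = y ∈ Nmin x

  -- paths: continuous maps from the index space ℕ (Nmin n = {n, n+1}),
  -- i.e. maps p with p (n+1) ∈ Nmin (p n)
  record Path : Set where
    constructor path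
    field
      at   : ℕ → X
      cont : ∀ n → at (suc n) ∈ Nmin (at n)
  open Path public

module _ {Atom : Set} (M₁ M₂ : QDModel Atom) where
  private
    module M₁ = QDModel M₁
    module M₂ = QDModel M₂

  RelX : Set₁
  RelX = M₁.X → M₂.X → Set

  IsModalBisim : RelX → Set
  IsModalBisim ρ = ∀ {x₁ x₂} → ρ x₁ x₂ →
      (M₁.V x₁ ≐ M₂.V x₂)
    × (∀ {y₁} → M₁.R x₁ y₁ → ∃[ y₂ ] (M₂.R x₂ y₂ × ρ y₁ y₂))
    × (∀ {y₂} → M₂.R x₂ y₂ → ∃[ y₁ ] (M₁.R x₁ y₁ × ρ y₁ y₂))

  IsModalBisimConv : RelX → Set
  IsModalBisimConv ρ = IsModalBisim ρ ×
    (∀ {x₁ x₂} → ρ x₁ x₂ →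
        (∀ {y₁} → M₁.R y₁ x₁ → ∃[ y₂ ] (M₂.R y₂ x₂ × ρ y₁ y₂))
      × (∀ {y₂} → M₂.R y₂ x₂ → ∃[ y₁ ] (M₁.R y₁ x₁ × ρ y₁ y₂)))

  NbhdBisimConds : RelX → M₁.X → M₂.X → Set₁
  NbhdBisimConds Z x₁ x₂ =
      (M₁.V x₁ ≐ M₂.V x₂)
    × (∀ (N₂ : Pred M₂.X 0ℓ) → N₂ ∈ M₂.𝒩 x₂ →
         Σ (Pred M₁.X 0ℓ) λ N₁ → N₁ ∈ M₁.𝒩 x₁ ×
           (∀ {y₁} → y₁ ∈ N₁ → ∃[ y₂ ] (y₂ ∈ N₂ × Z y₁ y₂)))
    × (∀ (N₁ : Pred M₁.X 0ℓ) → N₁ ∈ M₁.𝒩 x₁ →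
         Σ (Pred M₂.X 0ℓ) λ N₂ → N₂ ∈ M₂.𝒩 x₂ ×
           (∀ {y₂} → y₂ ∈ N₂ → ∃[ y₁ ] (y₁ ∈ N₁ × Z y₁ y₂)))

  Rel₁ : Set₁
  Rel₁ = M₁.Path → ℕ → M₂.Path → ℕ → Set

  Rel₂ : Set₁
  Rel₂ = M₂.Path → ℕ → M₁.Path → ℕ → Set

  -- path preserving bisimulation (Z𝒩 , Z₁ , Z₂); path sets are all paths.
  record IsPathPresBisim (Z : RelX) (Z₁ : Rel₁) (Z₂ : Rel₂) : Set₁ where
    field
      nonempty : ∃[ x₁ ] ∃[ x₂ ] Z x₁ x₂
      c1 : ∀ {x₁ x₂} → Z x₁ x₂ → NbhdBisimConds Z x₁ x₂
      c2 : ∀ {x₁ x₂} → Z x₁ x₂ → (p : M₁.Path) → M₁.at p 0 ≡ x₁ → ∀ n → n ≢ 0 →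
             Σ M₂.Path λ q → M₂.at q 0 ≡ x₂ × ∃[ m ] (Z (M₁.at p n) (M₂.at q m) × Z₁ p n q m)
      c3 : ∀ {x₁ x₂} → Z x₁ x₂ → (p : M₁.Path) → ∀ n → M₁.at p n ≡ x₁ → n ≢ 0 →
             Σ M₂.Path λ q → ∃[ m ] (M₂.at q m ≡ x₂ × Z (M₁.at p 0) (M₂.at q 0) × Z₁ p n q m)
      c4 : ∀ {p n q m} → Z₁ p n q m → ∀ kq → 0 < kq → kq < m →
             ∃[ kp ] (0 < kp × kp < n × Z (M₁.at p kp) (M₂.at q kq))
      c5 : ∀ {x₁ x₂} → Z x₁ x₂ → (q : M₂.Path) → M₂.at q 0 ≡ x₂ → ∀ m → m ≢ 0 →
             Σ M₁.Path λ p → M₁.at p 0 ≡ x₁ × ∃[ n ] (Z (M₁.at p n) (M₂.at q m) × Z₂ q m p n)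
      c6 : ∀ {x₁ x₂} → Z x₁ x₂ → (q : M₂.Path) → ∀ m → M₂.at q m ≡ x₂ → m ≢ 0 →
             Σ M₁.Path λ p → ∃[ n ] (M₁.at p n ≡ x₁ × Z (M₁.at p 0) (M₂.at q 0) × Z₂ q m p n)
      c7 : ∀ {q m p n} → Z₂ q m p n → ∀ kp → 0 < kp → kp < n →
             ∃[ kq ] (0 < kq × kq < m × Z (M₁.at p kp) (M₂.at q kq))

-- In a quasi-discrete space every neighbourhood filter is generated by the minimal
-- neighbourhood, so the neighbourhood bisimulation conditions at a pair are just the
-- forth and back conditions along the edge relation R.
-- (1) The converse conditions come from clause (3) applied to the one-edge path
-- y, x, x, … with n = 1: clause (4) forbids the matching index m from exceeding 1,
-- so q 0 → q m = x₂ is an edge (a loop when m = 0).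
-- (2) Forth conditions lift a path forwards from its start, converse conditions lift
-- it backwards from any position, both pointwise related and with the same indices;
-- hence clauses (4) and (7) themselves can serve as Z₁ and Z₂.
module Submission where

open import Defs
open import Level using (0ℓ)
open import Data.Nat using (ℕ; zero; suc; _<_; _≤_; z≤n; s≤s)
open import Data.Nat.Properties using (<⇒≤)
open import Data.Product using (Σ; ∃-syntax; _×_; _,_; proj₁; proj₂)
open import Function using (flip)
open import Relation.Binary.PropositionalEquality using (_≡_; _≢_; refl; subst)
open import Relation.Unary using (Pred; _∈_)

module _ {Atom : Set} (M : QDModel Atom) where
  open QDModel M

  R-refl : ∀ x → R x x
  R-refl x = point-in (Nmin-nbh x)

  R-at-≤1 : (p : Path) → ∀ {m} → m ≤ 1 → R (at p 0) (at p m)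
  R-at-≤1 p z≤n       = R-refl (at p 0)
  R-at-≤1 p (s≤s z≤n) = cont p 0

  constPath : X → Path
  constPath x = path (λ _ → x) (λ _ → R-refl x)

  tailPath : Path → Path
  tailPath p = path (λ k → at p (suc k)) (λ k → cont p (suc k))

  consPath : (x : X) (p : Path) → R x (at p 0) → Path
  consPath x p x→p₀ = path f f-cont
    where
      f : ℕ → X
      f zero    = x
      f (suc k) = at p k

      f-cont : ∀ k → R (f k) (f (suc k))
      f-cont zero    = x→p₀
      f-cont (suc k) = cont p k

module _ {Atom : Set} (A B : QDModel Atom) where
  private
    module A = QDModel A
    module B = QDModel B

  -- IsModalBisim, IsModalBisimConv and NbhdBisimConds unfold definitionally into these
  -- conditions for (M₁, M₂, ρ) and (M₂, M₁, flip ρ).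
  Forth : (A.X → B.X → Set) → A.X → B.X → Set
  Forth Z a b = ∀ {a'} → A.R a a' → ∃[ b' ] (B.R b b' × Z a' b')

  ConverseForth : (A.X → B.X → Set) → A.X → B.X → Set
  ConverseForth Z a b = ∀ {a'} → A.R a' a → ∃[ b' ] (B.R b' b × Z a' b')

  NbhdForth : (A.X → B.X → Set) → A.X → B.X → Set₁
  NbhdForth Z a b =
    ∀ (N' : Pred B.X 0ℓ) → N' ∈ B.𝒩 b →
      Σ (Pred A.X 0ℓ) λ N → N ∈ A.𝒩 a × (∀ {a'} → a' ∈ N → ∃[ b' ] (b' ∈ N' × Z a' b'))

  -- Clauses (2)–(4) of a path preserving bisimulation; (5)–(7) are the same clauses
  -- for the converse relation with the roles of the models exchanged.
  record PathSimulation (Z : A.X → B.X → Set) (Z₁ : A.Path → ℕ → B.Path → ℕ → Set) : Set where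
    field
      paths-from : ∀ {a b} → Z a b → (p : A.Path) → A.at p 0 ≡ a → ∀ n → n ≢ 0 →
        Σ B.Path λ q → B.at q 0 ≡ b × ∃[ m ] (Z (A.at p n) (B.at q m) × Z₁ p n q m)
      paths-into : ∀ {a b} → Z a b → (p : A.Path) → ∀ n → A.at p n ≡ a → n ≢ 0 →
        Σ B.Path λ q → ∃[ m ] (B.at q m ≡ b × Z (A.at p 0) (B.at q 0) × Z₁ p n q m)
      interior : ∀ {p n q m} → Z₁ p n q m → ∀ kq → 0 < kq → kq < m →
        ∃[ kp ] (0 < kp × kp < n × Z (A.at p kp) (B.at q kq))

  InteriorMatched : (A.X → B.X → Set) → A.Path → ℕ → B.Path → ℕ → Set
  InteriorMatched Z p n q m =
    ∀ kq → 0 < kq → kq < m → ∃[ kp ] (0 < kp × kp < n × Z (A.at p kp) (B.at q kq))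

module _ {Atom : Set} (A B : QDModel Atom) {Z : QDModel.X A → QDModel.X B → Set} where
  private
    module A = QDModel A
    module B = QDModel B

  nbhdForth⇒forth : ∀ {a b} → NbhdForth A B Z a b → Forth A B Z a b
  nbhdForth⇒forth {a} {b} nbhdForth a→a' with nbhdForth (B.Nmin b) (B.Nmin-nbh b)
  ... | N , N∈𝒩a , matched = matched (A.Nmin-min a N∈𝒩a a→a')

  forth⇒nbhdForth : ∀ {a b} → Forth A B Z a b → NbhdForth A B Z a b
  forth⇒nbhdForth {a} {b} forth N' N'∈𝒩b = A.Nmin a , A.Nmin-nbh a , matched
    where
      matched : ∀ {a'} → A.R a a' → ∃[ b' ] (b' ∈ N' × Z a' b')
      matched a→a' with forth a→a'
      ... | b' , b→b' , z = b' , B.Nmin-min b N'∈𝒩b b→b' , z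

  interior-index≤1 : ∀ {Z₁} → PathSimulation A B Z Z₁ → ∀ {p q m} → Z₁ p 1 q m → m ≤ 1
  interior-index≤1 S {m = zero}        _ = z≤n
  interior-index≤1 S {m = suc zero}    _ = s≤s z≤n
  interior-index≤1 S {m = suc (suc _)} z₁ with PathSimulation.interior S z₁ 1 (s≤s z≤n) (s≤s (s≤s z≤n))
  ... | zero  , () , _
  ... | suc _ , _  , s≤s () , _

  pathSimulation⇒converseForth : ∀ {Z₁} → PathSimulation A B Z Z₁ →
    ∀ {a b} → Z a b → ConverseForth A B Z a b
  pathSimulation⇒converseForth S {a} {b} z {a'} a'→a
    with PathSimulation.paths-into S z (consPath A a' (constPath A a) a'→a) 1 refl (λ ())
  ... | q , m , qm≡b , z₀ , z₁ =
    B.at q 0 , subst (B.R (B.at q 0)) qm≡b (R-at-≤1 B q (interior-index≤1 S z₁)) , z₀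

  liftFrom : (∀ {a b} → Z a b → Forth A B Z a b) →
    (p : A.Path) → ∀ {b} → Z (A.at p 0) b →
    Σ B.Path λ q → B.at q 0 ≡ b × (∀ k → Z (A.at p k) (B.at q k))
  liftFrom forth p {b} z = q , refl , λ k → proj₂ (trace k)
    where
      trace : ∀ k → Σ B.X (Z (A.at p k))
      trace zero    = b , z
      trace (suc k) = let b' , _ , z' = forth (proj₂ (trace k)) (A.cont p k) in b' , z'

      q : B.Path
      q = B.path (λ k → proj₁ (trace k)) (λ k → proj₁ (proj₂ (forth (proj₂ (trace k)) (A.cont p k))))

  liftInto : (∀ {a b} → Z a b → ConverseForth A B Z a b) →
    ∀ n (p : A.Path) {b} → Z (A.at p n) b →
    Σ B.Path λ q → B.at q n ≡ b × (∀ k → k ≤ n → Z (A.at p k) (B.at q k))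
  liftInto converseForth zero p {b} z = constPath B b , refl , λ { zero z≤n → z }
  liftInto converseForth (suc n) p z with liftInto converseForth n (tailPath A p) z
  ... | q , qn≡b , matched with converseForth (matched 0 z≤n) (A.cont p 0)
  ... | b₀ , b₀→q₀ , z₀ =
    consPath B b₀ q b₀→q₀ , qn≡b , λ { zero _ → z₀ ; (suc k) (s≤s k≤n) → matched k k≤n }

  interiorMatched-diagonal : ∀ p q {n} → (∀ k → k < n → Z (A.at p k) (B.at q k)) →
    InteriorMatched A B Z p n q n
  interiorMatched-diagonal p q matched k 0<k k<n = k , 0<k , k<n , matched k k<n

  forth×converseForth⇒pathSimulation :
    (∀ {a b} → Z a b → Forth A B Z a b) → (∀ {a b} → Z a b → ConverseForth A B Z a b) →
    PathSimulation A B Z (InteriorMatched A B Z)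
  forth×converseForth⇒pathSimulation forth converseForth = record
    { paths-from = paths-from
    ; paths-into = paths-into
    ; interior   = λ z₁ → z₁
    }
    where
      paths-from : ∀ {a b} → Z a b → (p : A.Path) → A.at p 0 ≡ a → ∀ n → n ≢ 0 →
        Σ B.Path λ q → B.at q 0 ≡ b × ∃[ m ] (Z (A.at p n) (B.at q m) × InteriorMatched A B Z p n q m)
      paths-from z p refl n _ with liftFrom forth p z
      ... | q , q₀≡b , matched = q , q₀≡b , n , matched n , interiorMatched-diagonal p q (λ k _ → matched k)

      paths-into : ∀ {a b} → Z a b → (p : A.Path) → ∀ n → A.at p n ≡ a → n ≢ 0 →
        Σ B.Path λ q → ∃[ m ] (B.at q m ≡ b × Z (A.at p 0) (B.at q 0) × InteriorMatched A B Z p n q m)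
      paths-into z p n refl _ with liftInto converseForth n p z
      ... | q , qn≡b , matched =
        q , n , qn≡b , matched 0 z≤n , interiorMatched-diagonal p q (λ k k<n → matched k (<⇒≤ k<n))

module _ {Atom : Set} (M₁ M₂ : QDModel Atom) where
  pathPresBisim⇒pathSimulations : ∀ {Z Z₁ Z₂} → IsPathPresBisim M₁ M₂ Z Z₁ Z₂ →
    PathSimulation M₁ M₂ Z Z₁ × PathSimulation M₂ M₁ (flip Z) Z₂
  pathPresBisim⇒pathSimulations PB =
    record { paths-from = c2 ; paths-into = c3 ; interior = c4 } ,
    record { paths-from = c5 ; paths-into = c6 ; interior = c7 }
    where open IsPathPresBisim PB

  pathSimulations⇒pathPresBisim : ∀ {Z Z₁ Z₂} → (∃[ x₁ ] ∃[ x₂ ] Z x₁ x₂) →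
    (∀ {x₁ x₂} → Z x₁ x₂ → NbhdBisimConds M₁ M₂ Z x₁ x₂) →
    PathSimulation M₁ M₂ Z Z₁ → PathSimulation M₂ M₁ (flip Z) Z₂ →
    IsPathPresBisim M₁ M₂ Z Z₁ Z₂
  pathSimulations⇒pathPresBisim nonempty nbhd S₁₂ S₂₁ = record
    { nonempty = nonempty
    ; c1 = nbhd
    ; c2 = paths-from S₁₂ ; c3 = paths-into S₁₂ ; c4 = interior S₁₂
    ; c5 = paths-from S₂₁ ; c6 = paths-into S₂₁ ; c7 = interior S₂₁
    }
    where open PathSimulation

lemma28 : ∀ {Atom : Set} (M₁ M₂ : QDModel Atom) →
    (∀ (Z : RelX M₁ M₂) (Z₁ : Rel₁ M₁ M₂) (Z₂ : Rel₂ M₁ M₂) →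
       IsPathPresBisim M₁ M₂ Z Z₁ Z₂ → IsModalBisimConv M₁ M₂ Z)
    × (∀ (ρ : RelX M₁ M₂) → (∃[ x₁ ] ∃[ x₂ ] ρ x₁ x₂) → IsModalBisimConv M₁ M₂ ρ →
       Σ (Rel₁ M₁ M₂) λ Z₁ → Σ (Rel₂ M₁ M₂) λ Z₂ → IsPathPresBisim M₁ M₂ ρ Z₁ Z₂)
lemma28 M₁ M₂ = pathPres⇒modal , modal⇒pathPres
  where
    pathPres⇒modal : ∀ Z Z₁ Z₂ → IsPathPresBisim M₁ M₂ Z Z₁ Z₂ → IsModalBisimConv M₁ M₂ Z
    pathPres⇒modal Z Z₁ Z₂ PB =
      (λ z → let atoms , nbhdForth , nbhdBack = c1 z
             in atoms , nbhdForth⇒forth M₁ M₂ nbhdForth , nbhdForth⇒forth M₂ M₁ nbhdBack) ,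
      (λ z → pathSimulation⇒converseForth M₁ M₂ S₁₂ z , pathSimulation⇒converseForth M₂ M₁ S₂₁ z)
      where
        open IsPathPresBisim PB
        S₁₂ : PathSimulation M₁ M₂ Z Z₁
        S₁₂ = proj₁ (pathPresBisim⇒pathSimulations M₁ M₂ PB)
        S₂₁ : PathSimulation M₂ M₁ (flip Z) Z₂
        S₂₁ = proj₂ (pathPresBisim⇒pathSimulations M₁ M₂ PB)

    modal⇒pathPres : ∀ ρ → (∃[ x₁ ] ∃[ x₂ ] ρ x₁ x₂) → IsModalBisimConv M₁ M₂ ρ →
      Σ (Rel₁ M₁ M₂) λ Z₁ → Σ (Rel₂ M₁ M₂) λ Z₂ → IsPathPresBisim M₁ M₂ ρ Z₁ Z₂
    modal⇒pathPres ρ nonempty (modal , converse) =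
      InteriorMatched M₁ M₂ ρ , InteriorMatched M₂ M₁ (flip ρ) ,
      pathSimulations⇒pathPresBisim M₁ M₂ nonempty
        (λ z → proj₁ (modal z) , forth⇒nbhdForth M₁ M₂ (forth z) , forth⇒nbhdForth M₂ M₁ (back z))
        (forth×converseForth⇒pathSimulation M₁ M₂ forth (λ z → proj₁ (converse z)))
        (forth×converseForth⇒pathSimulation M₂ M₁ back (λ z → proj₂ (converse z)))
      where
        forth : ∀ {x₁ x₂} → ρ x₁ x₂ → Forth M₁ M₂ ρ x₁ x₂
        forth z = proj₁ (proj₂ (modal z))

        back : ∀ {x₂ x₁} → ρ x₁ x₂ → Forth M₂ M₁ (flip ρ) x₂ x₁
        back z = proj₂ (proj₂ (modal z))
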